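{- Let $q$ be odd, let $\Pi_q$ be a projective plane of order $q$ with point set $\mathcal{P}$ and line set $\mathcal{L}$, and let $\mathcal{O}$ be an oval in $\Pi_q$. Define $\mathcal{L}_1$ as the set of lines skew to $\mathcal{O}$ and $\mathcal{P}_1$ as the set of interior points of $\mathcal{O}$; define $\mathcal{L}_1^*$ as the set of lines that are skew or tangent to $\mathcal{O}$ and $\mathcal{P}_1^*$ as the set of exterior points of $\mathcal{O}$. Then both $\big(\mathcal{P}_1\cup\mathcal{L}_1\big)\cup\big((\mathcal{P}\setminus\mathcal{P}_1)\cup(\mathcal{L}\setminus\mathcal{L}_1)\big)$ and $\big(\mathcal{P}_1^*\cup\mathcal{L}_1^*\big)\cup\big((\mathcal{P}\setminus\mathcal{P}_1^*)\cup(\mathcal{L}\setminus\mathcal{L}_1^*)\big)$ are internal partitions of the point-line incidence graph of $\Pi_q$.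
   Context: A projective plane of order $q$ is an incidence structure of points and lines in which any two points lie on a unique line, any two lines meet in a unique point, every line has $q+1$ points and every point lies on $q+1$ lines. An arc is a set of points no three of which are collinear; an oval is an arc with $q+1$ points. For a point set $K$, a line $\ell$ is a tangent to $K$ if $|K\cap\ell|=1$ and skew to $K$ if $K\cap\ell=\emptyset$. For $q$ odd, every point not on an oval $\mathcal{O}$ lies on either $0$ or $2$ tangents of $\mathcal{O}$; it is called an interior point of $\mathcal{O}$ in the first case and an exterior point in the second. The point-line incidence graph is the bipartite graph on points and lines with adjacency given by incidence. For a graph $G$, $d(v)$ is the degree of $v$ and $d_U(v)$ the number of neighbours of $v$ in $U$. An internal partition of $G$ is a partition $V(G)=A\cup B$ into two nonempty sets with $d_A(v)\ge d(v)/2$ for all $v\in A$ and $d_B(v)\ge d(v)/2$ for all $v\in B$. -}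

module Defs where

open import Data.Nat using (ℕ; zero; suc; _+_; _*_; _≤_; _≡ᵇ_)
open import Data.Bool using (Bool; true; false; not; _∧_; if_then_else_)
open import Data.Fin using (Fin)
import Data.Fin as F
open import Data.Sum using (_⊎_; inj₁; inj₂)
open import Data.Product using (Σ; _×_; ∃)
open import Relation.Binary.PropositionalEquality using (_≡_; _≢_)
open import Relation.Nullary using (¬_)

count : {n : ℕ} → (Fin n → Bool) → ℕ
count {zero}  f = 0
count {suc n} f = (if f F.zero then 1 else 0) + count (λ i → f (F.suc i))

record IsProjectivePlane (q np nl : ℕ) (I : Fin np → Fin nl → Bool) : Set where
  field
    order≥2      : 2 ≤ q
    two-points   : ∀ p p′ → p ≢ p′ →
                   Σ (Fin nl) λ l → I p l ≡ true × I p′ l ≡ true ×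
                     (∀ l′ → I p l′ ≡ true → I p′ l′ ≡ true → l′ ≡ l)
    two-lines    : ∀ l l′ → l ≢ l′ →
                   Σ (Fin np) λ p → I p l ≡ true × I p l′ ≡ true ×
                     (∀ p′ → I p′ l ≡ true → I p′ l′ ≡ true → p′ ≡ p)
    line-size    : ∀ l → count (λ p → I p l) ≡ suc q
    point-degree : ∀ p → count (λ l → I p l) ≡ suc q

module _ {np nl : ℕ} (I : Fin np → Fin nl → Bool) where

  IsArc : (Fin np → Bool) → Set
  IsArc K = ∀ x y z → K x ≡ true → K y ≡ true → K z ≡ true →
            x ≢ y → y ≢ z → x ≢ z →
            ∀ l → ¬ (I x l ≡ true × I y l ≡ true × I z l ≡ true)

  IsOval : ℕ → (Fin np → Bool) → Set
  IsOval q K = IsArc K × count K ≡ suc q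

  meet : (Fin np → Bool) → Fin nl → ℕ
  meet K l = count (λ p → I p l ∧ K p)

  isSkew : (Fin np → Bool) → Fin nl → Bool
  isSkew K l = meet K l ≡ᵇ 0

  isTangent : (Fin np → Bool) → Fin nl → Bool
  isTangent K l = meet K l ≡ᵇ 1

  isSkewOrTangent : (Fin np → Bool) → Fin nl → Bool
  isSkewOrTangent K l = if isSkew K l then true else isTangent K l

  tangentsThrough : (Fin np → Bool) → Fin np → ℕ
  tangentsThrough K p = count (λ l → I p l ∧ isTangent K l)

  isInterior : (Fin np → Bool) → Fin np → Bool
  isInterior K p = not (K p) ∧ (tangentsThrough K p ≡ᵇ 0)

  isExterior : (Fin np → Bool) → Fin np → Bool
  isExterior K p = not (K p) ∧ (tangentsThrough K p ≡ᵇ 2)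

  Vertex : Set
  Vertex = Fin np ⊎ Fin nl

  adj : Vertex → Vertex → Bool
  adj (inj₁ p) (inj₁ p′) = false
  adj (inj₁ p) (inj₂ l)  = I p l
  adj (inj₂ l) (inj₁ p)  = I p l
  adj (inj₂ l) (inj₂ l′) = false

  countV : (Vertex → Bool) → ℕ
  countV U = count (λ p → U (inj₁ p)) + count (λ l → U (inj₂ l))

  deg : Vertex → ℕ
  deg v = countV (adj v)

  degIn : (Vertex → Bool) → Vertex → ℕ
  degIn U v = countV (λ w → adj v w ∧ U w)

  IsInternalPartition : (Vertex → Bool) → Set
  IsInternalPartition A =
    (∃ λ v → A v ≡ true) × (∃ λ v → A v ≡ false) ×
    (∀ v → A v ≡ true  → deg v ≤ 2 * degIn A v) ×
    (∀ v → A v ≡ false → deg v ≤ 2 * degIn (λ w → not (A w)) v)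

  part : (Fin np → Bool) → (Fin nl → Bool) → Vertex → Bool
  part P L (inj₁ p) = P p
  part P L (inj₂ l) = L l

{-# OPTIONS --safe #-}

-- Let ν, τ, σ be the numbers of skew, tangent and secant lines through a point p. Counting the
-- lines through p and their incidences with the oval O gives ν + τ + σ = q + 1 and
-- τ + 2σ = q + 1 + q·[p ∈ O]. Hence τ = 1 on O and, q being odd, τ is even off O; counting along
-- a tangent then shows τ ≤ 2. So (ν, τ, σ) is (0, 1, q) on O, (h, 0, h) at interior points and
-- (h − 1, 2, h − 1) at exterior points, where 2h = q + 1. The q + 1 tangents thus form an oval of
-- the dual plane, and the same table, read dually, counts the interior, oval and exterior points
-- on a skew, tangent or secant line. In both partitions every vertex therefore has at least h of
-- its q + 1 neighbours on its own side.

module Submission where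

open import Defs
open import Data.Nat using (ℕ; _%_)
open import Data.Bool using (Bool)
open import Data.Fin using (Fin)
open import Data.Product using (_×_)
open import Relation.Binary.PropositionalEquality using (_≡_)

open import Data.Nat using (zero; suc; _+_; _*_; _≤_; _<_; _≡ᵇ_; z≤n; s≤s; s≤s⁻¹; z<s)
open import Data.Nat.Properties hiding (_≟_)
open import Data.Nat.DivMod using (m*n%n≡0)
open import Data.Nat.Tactic.RingSolver using (solve-∀)
open import Data.Bool using (true; false; not; _∧_; if_then_else_; T)
open import Data.Bool.Properties using (∧-conicalˡ; ∧-conicalʳ; ∧-identityʳ; ∧-zeroʳ; ∧-idem)
open import Data.Unit using (tt)
open import Data.Fin using (zero; suc)
open import Data.Fin.Properties using (_≟_)
open import Data.Product using (∃; _,_; proj₁; proj₂; map₂)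
open import Data.Sum using (inj₁; inj₂)
open import Function using (_∘_; flip)
open import Relation.Binary.PropositionalEquality
  using (_≢_; _≗_; refl; sym; trans; cong; cong₂; subst; ≢-sym; module ≡-Reasoning)
open import Relation.Nullary using (¬_; does; yes; no; contradiction)
open import Relation.Nullary.Decidable using (dec-true)
open import Algebra.Properties.Semiring.Sum +-*-semiring
  using (sum-syntax; sum-cong-≗; sum-replicate-zero; ∑-distrib-+; ∑-comm; *-distribˡ-sum)

-- Counting over Fin

𝟙 : Bool → ℕ
𝟙 b = if b then 1 else 0

𝟙-∧ : ∀ a b → 𝟙 (a ∧ b) ≡ 𝟙 a * 𝟙 b
𝟙-∧ true  b = sym (*-identityˡ (𝟙 b))
𝟙-∧ false b = refl

≡ᵇ-true⇒≡ : ∀ {m n} → (m ≡ᵇ n) ≡ true → m ≡ n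
≡ᵇ-true⇒≡ {m} {n} e = ≡ᵇ⇒≡ m n (subst T (sym e) tt)

count≡∑𝟙 : ∀ {n} (f : Fin n → Bool) → count f ≡ ∑[ i < n ] 𝟙 (f i)
count≡∑𝟙 {zero}  f = refl
count≡∑𝟙 {suc n} f = cong (𝟙 (f zero) +_) (count≡∑𝟙 (f ∘ suc))

count-cong : ∀ {n} {f g : Fin n → Bool} → f ≗ g → count f ≡ count g
count-cong {zero}  f≗g = refl
count-cong {suc n} f≗g = cong₂ _+_ (cong 𝟙 (f≗g zero)) (count-cong (f≗g ∘ suc))

count-false : ∀ {n} → count {n} (λ _ → false) ≡ 0
count-false {zero}  = refl
count-false {suc n} = count-false {n}

count-+ : ∀ {n} {f g h : Fin n → Bool} → (∀ i → 𝟙 (f i) ≡ 𝟙 (g i) + 𝟙 (h i)) →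
          count f ≡ count g + count h
count-+ {n} {f} {g} {h} split = begin
  count f                                    ≡⟨ count≡∑𝟙 f ⟩
  ∑[ i < n ] 𝟙 (f i)                         ≡⟨ sum-cong-≗ split ⟩
  ∑[ i < n ] (𝟙 (g i) + 𝟙 (h i))             ≡⟨ ∑-distrib-+ (𝟙 ∘ g) (𝟙 ∘ h) ⟩
  ∑[ i < n ] 𝟙 (g i) + ∑[ i < n ] 𝟙 (h i)    ≡⟨ cong₂ _+_ (count≡∑𝟙 g) (count≡∑𝟙 h) ⟨
  count g + count h                          ∎
  where open ≡-Reasoning

count-∧-not : ∀ {n} (a b : Fin n → Bool) →
              count (λ i → a i ∧ b i) + count (λ i → a i ∧ not (b i)) ≡ count a
count-∧-not a b = sym (count-+ λ i → split (a i) (b i))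
  where
  split : ∀ x y → 𝟙 x ≡ 𝟙 (x ∧ y) + 𝟙 (x ∧ not y)
  split false y     = refl
  split true  true  = refl
  split true  false = refl

count>0⇒∃ : ∀ {n} (f : Fin n → Bool) → 0 < count f → ∃ λ i → f i ≡ true
count>0⇒∃ {suc n} f pos with f zero in f0
... | true  = zero , f0
... | false with count>0⇒∃ (f ∘ suc) pos
...   | i , fi = suc i , fi

_∖_ : ∀ {n} → (Fin n → Bool) → Fin n → Fin n → Bool
(f ∖ i) j = f j ∧ not (does (j ≟ i))

∈∖⇒ : ∀ {n} {f : Fin n → Bool} {i j} → (f ∖ i) j ≡ true → f j ≡ true × j ≢ i
∈∖⇒ {f = f} {i} {j} e = ∧-conicalˡ (f j) _ e , j≢i
  where
  j≢i : j ≢ i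
  j≢i refl = contradiction (trans (cong not (sym (dec-true (i ≟ i) refl))) (∧-conicalʳ (f i) _ e)) λ ()

count-∖ : ∀ {n} (f : Fin n → Bool) {i} → f i ≡ true → count f ≡ suc (count (f ∖ i))
count-∖ {suc n} f {zero} fi rewrite fi = cong suc (sym (count-cong (∧-identityʳ ∘ f ∘ suc)))
count-∖ {suc n} f {suc i} fi = begin
  𝟙 (f zero) + count (f ∘ suc)   ≡⟨ cong (𝟙 (f zero) +_) (count-∖ (f ∘ suc) fi) ⟩
  𝟙 (f zero) + suc rest          ≡⟨ +-suc (𝟙 (f zero)) rest ⟩
  suc (𝟙 (f zero) + rest)        ≡⟨ cong (λ b → suc (𝟙 b + rest)) (∧-identityʳ (f zero)) ⟨
  suc (𝟙 (f zero ∧ true) + rest) ∎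
  where
  open ≡-Reasoning
  rest : ℕ
  rest = count ((f ∘ suc) ∖ i)

∃⇒count>0 : ∀ {n} (f : Fin n → Bool) {i} → f i ≡ true → 0 < count f
∃⇒count>0 f fi = subst (0 <_) (sym (count-∖ f fi)) z<s

count>k⇒∃ : ∀ {n k} (f : Fin n → Bool) → k < count f → ∃ λ i → f i ≡ true × k ≤ count (f ∖ i)
count>k⇒∃ f k<count with count>0⇒∃ f (≤-trans (s≤s z≤n) k<count)
... | i , fi = i , fi , s≤s⁻¹ (subst (_ <_) (count-∖ f fi) k<count)

count>2⇒three : ∀ {n} (f : Fin n → Bool) → 2 < count f →
  ∃ λ x → ∃ λ y → ∃ λ z → (f x ≡ true × f y ≡ true × f z ≡ true) × (x ≢ y × y ≢ z × x ≢ z)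
count>2⇒three f 2<count with count>k⇒∃ f 2<count
... | x , fx , 1<f∖x with count>k⇒∃ (f ∖ x) 1<f∖x
... | y , y∈f∖x , 0<f∖x∖y with count>0⇒∃ ((f ∖ x) ∖ y) 0<f∖x∖y
... | z , z∈f∖x∖y with ∈∖⇒ {f = f} y∈f∖x | ∈∖⇒ {f = f ∖ x} z∈f∖x∖y
... | fy , y≢x | z∈f∖x , z≢y with ∈∖⇒ {f = f} z∈f∖x
... | fz , z≢x = x , y , z , (fx , fy , fz) , (≢-sym y≢x , ≢-sym z≢y , ≢-sym z≢x)

count≡1 : ∀ {n} (f : Fin n → Bool) {i} → f i ≡ true → (∀ j → f j ≡ true → j ≡ i) → count f ≡ 1
count≡1 {n} f {i} fi unique = trans (count-∖ f fi) (cong suc (trans (count-cong others) (count-false {n})))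
  where
  others : ∀ j → (f ∖ i) j ≡ false
  others j with f j in fj | j ≟ i
  ... | false | _      = refl
  ... | true  | yes _  = refl
  ... | true  | no j≢i = contradiction (unique j fj) j≢i

∑𝟙*≡count : ∀ {n} {a : Fin n → Bool} {f : Fin n → ℕ} → (∀ i → a i ≡ true → f i ≡ 1) →
            ∑[ i < n ] (𝟙 (a i) * f i) ≡ count a
∑𝟙*≡count {n} {a} {f} f≡1 = trans (sum-cong-≗ {n} one) (sym (count≡∑𝟙 a))
  where
  one : ∀ i → 𝟙 (a i) * f i ≡ 𝟙 (a i)
  one i with a i in ai
  ... | true  = trans (+-identityʳ (f i)) (f≡1 i ai)
  ... | false = refl

∑-δ : ∀ {n} (i : Fin n) (f : Fin n → ℕ) → ∑[ j < n ] (𝟙 (does (j ≟ i)) * f j) ≡ f i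
∑-δ {suc n} zero    f = trans (cong₂ _+_ (*-identityˡ (f zero)) (sum-replicate-zero n)) (+-identityʳ (f zero))
∑-δ {suc n} (suc i) f = ∑-δ i (f ∘ suc)

∑-mono-≤ : ∀ {n} {f g : Fin n → ℕ} → (∀ i → f i ≤ g i) → ∑[ i < n ] f i ≤ ∑[ i < n ] g i
∑-mono-≤ {zero}  f≤g = z≤n
∑-mono-≤ {suc n} f≤g = +-mono-≤ (f≤g zero) (∑-mono-≤ (f≤g ∘ suc))

∑-tight : ∀ {n} {f g : Fin n → ℕ} → (∀ i → f i ≤ g i) → ∑[ i < n ] g i ≤ ∑[ i < n ] f i →
          ∀ i → f i ≡ g i
∑-tight {suc n} {f} {g} f≤g ∑g≤∑f zero = ≤-antisym (f≤g zero) (+-cancelʳ-≤ _ _ _ (begin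
  g zero + ∑[ i < n ] g (suc i)   ≤⟨ ∑g≤∑f ⟩
  f zero + ∑[ i < n ] f (suc i)   ≤⟨ +-monoʳ-≤ (f zero) (∑-mono-≤ (f≤g ∘ suc)) ⟩
  f zero + ∑[ i < n ] g (suc i)   ∎))
  where open ≤-Reasoning
∑-tight {suc n} {f} {g} f≤g ∑g≤∑f (suc i) = ∑-tight (f≤g ∘ suc) (+-cancelˡ-≤ (f zero) _ _ (begin
  f zero + ∑[ i < n ] g (suc i)   ≤⟨ +-monoˡ-≤ _ (f≤g zero) ⟩
  g zero + ∑[ i < n ] g (suc i)   ≤⟨ ∑g≤∑f ⟩
  f zero + ∑[ i < n ] f (suc i)   ∎)) i
  where open ≤-Reasoning

tally : (ℕ → Bool) → ℕ → ℕ → ℕ → ℕ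
tally χ n₀ n₁ n₂ = (if χ 0 then n₀ else 0) + (if χ 1 then n₁ else 0) + (if χ 2 then n₂ else 0)

count-by-level : ∀ {n} {m : Fin n → ℕ} → (∀ i → m i ≤ 2) → (a : Fin n → Bool) (χ : ℕ → Bool) →
  count (λ i → a i ∧ χ (m i)) ≡
  tally χ (count (λ i → a i ∧ (m i ≡ᵇ 0))) (count (λ i → a i ∧ (m i ≡ᵇ 1))) (count (λ i → a i ∧ (m i ≡ᵇ 2)))
count-by-level {n} {m} m≤2 a χ = begin
  count (λ i → a i ∧ χ (m i))
    ≡⟨ count≡∑𝟙 (λ i → a i ∧ χ (m i)) ⟩
  ∑[ i < n ] 𝟙 (a i ∧ χ (m i))
    ≡⟨ sum-cong-≗ (λ i → split (a i) (m≤2 i)) ⟩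
  ∑[ i < n ] (𝟙 (at 0 i) + 𝟙 (at 1 i) + 𝟙 (at 2 i))
    ≡⟨ ∑-distrib-+ (λ i → 𝟙 (at 0 i) + 𝟙 (at 1 i)) (𝟙 ∘ at 2) ⟩
  ∑[ i < n ] (𝟙 (at 0 i) + 𝟙 (at 1 i)) + ∑[ i < n ] 𝟙 (at 2 i)
    ≡⟨ cong (_+ ∑[ i < n ] 𝟙 (at 2 i)) (∑-distrib-+ (𝟙 ∘ at 0) (𝟙 ∘ at 1)) ⟩
  ∑[ i < n ] 𝟙 (at 0 i) + ∑[ i < n ] 𝟙 (at 1 i) + ∑[ i < n ] 𝟙 (at 2 i)
    ≡⟨ cong₂ _+_ (cong₂ _+_ (count≡∑𝟙 (at 0)) (count≡∑𝟙 (at 1))) (count≡∑𝟙 (at 2)) ⟨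
  count (at 0) + count (at 1) + count (at 2)
    ≡⟨ cong₂ _+_ (cong₂ _+_ (count-at 0) (count-at 1)) (count-at 2) ⟩
  tally χ (count (level 0)) (count (level 1)) (count (level 2)) ∎
  where
  open ≡-Reasoning
  level at : ℕ → Fin n → Bool
  level k i = a i ∧ (m i ≡ᵇ k)
  at k i = level k i ∧ χ k
  split : ∀ {k} x → k ≤ 2 →
          𝟙 (x ∧ χ k) ≡ 𝟙 ((x ∧ (k ≡ᵇ 0)) ∧ χ 0) + 𝟙 ((x ∧ (k ≡ᵇ 1)) ∧ χ 1) + 𝟙 ((x ∧ (k ≡ᵇ 2)) ∧ χ 2)
  split false _               = refl
  split true  z≤n             = sym (trans (+-identityʳ _) (+-identityʳ _))
  split true  (s≤s z≤n)       = sym (+-identityʳ _)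
  split true  (s≤s (s≤s z≤n)) = refl
  count-at : ∀ k → count (at k) ≡ (if χ k then count (level k) else 0)
  count-at k with χ k
  ... | true  = count-cong (∧-identityʳ ∘ level k)
  ... | false = trans (count-cong (∧-zeroʳ ∘ level k)) (count-false {n})

-- Incidence structures and projective planes

∑-flags : ∀ {np nl} (I : Fin np → Fin nl → Bool) (A : Fin np → Bool) (B : Fin nl → Bool) →
  ∑[ p < np ] (𝟙 (A p) * count (λ l → I p l ∧ B l)) ≡ ∑[ l < nl ] (𝟙 (B l) * count (λ p → I p l ∧ A p))
∑-flags {np} {nl} I A B = begin
  ∑[ p < np ] (𝟙 (A p) * count (λ l → I p l ∧ B l))
    ≡⟨ expand I A B ⟩
  ∑[ p < np ] ∑[ l < nl ] (𝟙 (A p) * (𝟙 (I p l) * 𝟙 (B l)))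
    ≡⟨ ∑-comm (λ p l → 𝟙 (A p) * (𝟙 (I p l) * 𝟙 (B l))) ⟩
  ∑[ l < nl ] ∑[ p < np ] (𝟙 (A p) * (𝟙 (I p l) * 𝟙 (B l)))
    ≡⟨ sum-cong-≗ {nl} (λ l → sum-cong-≗ {np} λ p → swap (𝟙 (A p)) (𝟙 (I p l)) (𝟙 (B l))) ⟩
  ∑[ l < nl ] ∑[ p < np ] (𝟙 (B l) * (𝟙 (I p l) * 𝟙 (A p)))
    ≡⟨ expand (flip I) B A ⟨
  ∑[ l < nl ] (𝟙 (B l) * count (λ p → I p l ∧ A p)) ∎
  where
  open ≡-Reasoning
  swap : ∀ x y z → x * (y * z) ≡ z * (y * x)
  swap = solve-∀
  expand : ∀ {m n} (J : Fin m → Fin n → Bool) (C : Fin m → Bool) (D : Fin n → Bool) →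
    ∑[ x < m ] (𝟙 (C x) * count (λ y → J x y ∧ D y)) ≡ ∑[ x < m ] ∑[ y < n ] (𝟙 (C x) * (𝟙 (J x y) * 𝟙 (D y)))
  expand {m} {n} J C D = sum-cong-≗ {m} λ x → begin
    𝟙 (C x) * count (λ y → J x y ∧ D y)             ≡⟨ cong (𝟙 (C x) *_) (count≡∑𝟙 (λ y → J x y ∧ D y)) ⟩
    𝟙 (C x) * ∑[ y < n ] 𝟙 (J x y ∧ D y)            ≡⟨ cong (𝟙 (C x) *_) (sum-cong-≗ {n} λ y → 𝟙-∧ (J x y) (D y)) ⟩
    𝟙 (C x) * ∑[ y < n ] (𝟙 (J x y) * 𝟙 (D y))      ≡⟨ *-distribˡ-sum (𝟙 (C x)) (λ y → 𝟙 (J x y) * 𝟙 (D y)) ⟩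
    ∑[ y < n ] (𝟙 (C x) * (𝟙 (J x y) * 𝟙 (D y)))    ∎

arc⇒meet≤2 : ∀ {np nl} {I : Fin np → Fin nl → Bool} {K : Fin np → Bool} → IsArc I K → ∀ l → meet I K l ≤ 2
arc⇒meet≤2 {I = I} {K} arc l = ≮⇒≥ no-three
  where
  no-three : ¬ (2 < meet I K l)
  no-three 2<meet with count>2⇒three (λ x → I x l ∧ K x) 2<meet
  ... | x , y , z , (on-x , on-y , on-z) , (x≢y , y≢z , x≢z) =
    arc x y z (∧-conicalʳ (I x l) _ on-x) (∧-conicalʳ (I y l) _ on-y) (∧-conicalʳ (I z l) _ on-z) x≢y y≢z x≢z l
        (∧-conicalˡ _ (K x) on-x , ∧-conicalˡ _ (K y) on-y , ∧-conicalˡ _ (K z) on-z)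

dual : ∀ {q np nl} {I : Fin np → Fin nl → Bool} →
       IsProjectivePlane q np nl I → IsProjectivePlane q nl np (flip I)
dual P = record
  { order≥2      = order≥2
  ; two-points   = two-lines
  ; two-lines    = two-points
  ; line-size    = point-degree
  ; point-degree = line-size
  }
  where open IsProjectivePlane P

Majority : ℕ → ∀ {m n} → (Fin m → Fin n → Bool) → (Fin m → Bool) → (Fin n → Bool) → Set
Majority q I A B = ∀ p → suc q ≤ 2 * count (λ l → I p l ∧ (if A p then B l else not (B l)))

module Plane {q np nl : ℕ} {I : Fin np → Fin nl → Bool} (P : IsProjectivePlane q np nl I) where
  open IsProjectivePlane P

  lines-through-two-points : ∀ x p → count (λ l → I x l ∧ I p l) ≡ 1 + q * 𝟙 (does (x ≟ p))
  lines-through-two-points x p with x ≟ p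
  ... | yes refl = begin
    count (λ l → I x l ∧ I x l) ≡⟨ count-cong (λ l → ∧-idem (I x l)) ⟩
    count (λ l → I x l)         ≡⟨ point-degree x ⟩
    suc q                       ≡⟨ cong suc (*-identityʳ q) ⟨
    1 + q * 1                   ∎
    where open ≡-Reasoning
  ... | no x≢p with two-points x p x≢p
  ...   | l , Ixl , Ipl , unique = trans
    (count≡1 _ (cong₂ _∧_ Ixl Ipl) λ l′ e → unique l′ (∧-conicalˡ _ _ e) (∧-conicalʳ _ _ e))
    (cong suc (sym (*-zeroʳ q)))

  ∑-meet-through : ∀ K p → ∑[ l < nl ] (𝟙 (I p l) * meet I K l) ≡ count K + q * 𝟙 (K p)
  ∑-meet-through K p = begin
    ∑[ l < nl ] (𝟙 (I p l) * meet I K l)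
      ≡⟨ ∑-flags I K (I p) ⟨
    ∑[ x < np ] (𝟙 (K x) * count (λ l → I x l ∧ I p l))
      ≡⟨ sum-cong-≗ {np} (λ x → cong (𝟙 (K x) *_) (lines-through-two-points x p)) ⟩
    ∑[ x < np ] (𝟙 (K x) * (1 + q * 𝟙 (does (x ≟ p))))
      ≡⟨ sum-cong-≗ {np} (λ x → expand q (𝟙 (K x)) (𝟙 (does (x ≟ p)))) ⟩
    ∑[ x < np ] (𝟙 (K x) + q * (𝟙 (does (x ≟ p)) * 𝟙 (K x)))
      ≡⟨ ∑-distrib-+ (𝟙 ∘ K) (λ x → q * (𝟙 (does (x ≟ p)) * 𝟙 (K x))) ⟩
    ∑[ x < np ] 𝟙 (K x) + ∑[ x < np ] (q * (𝟙 (does (x ≟ p)) * 𝟙 (K x)))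
      ≡⟨ cong₂ _+_ (count≡∑𝟙 K) (*-distribˡ-sum q (λ x → 𝟙 (does (x ≟ p)) * 𝟙 (K x))) ⟨
    count K + q * ∑[ x < np ] (𝟙 (does (x ≟ p)) * 𝟙 (K x))
      ≡⟨ cong (λ n → count K + q * n) (∑-δ p (𝟙 ∘ K)) ⟩
    count K + q * 𝟙 (K p) ∎
    where
    open ≡-Reasoning
    expand : ∀ q k d → k * (1 + q * d) ≡ k + q * (d * k)
    expand = solve-∀

  regular : ∀ v → deg I v ≡ suc q
  regular (inj₁ p) = trans (cong (_+ count (I p)) (count-false {np})) (point-degree p)
  regular (inj₂ l) = trans (cong (count (λ p → I p l) +_) (count-false {nl})) (trans (+-identityʳ _) (line-size l))

  degIn-point : ∀ C p → degIn I C (inj₁ p) ≡ count (λ l → I p l ∧ C (inj₂ l))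
  degIn-point C p = cong (_+ count (λ l → I p l ∧ C (inj₂ l))) (count-false {np})

  degIn-line : ∀ C l → degIn I C (inj₂ l) ≡ count (λ x → I x l ∧ C (inj₁ x))
  degIn-line C l = trans (cong (count (λ x → I x l ∧ C (inj₁ x)) +_) (count-false {nl})) (+-identityʳ _)

  internal-part : ∀ {A B} → (∃ λ v → part I A B v ≡ true) → (∃ λ v → part I A B v ≡ false) →
                  Majority q I A B → Majority q (flip I) B A → IsInternalPartition I (part I A B)
  internal-part {A} {B} inside outside majority majority′ =
    inside , outside , (λ v → same-side v true) , (λ v → same-side v false)
    where
    V : Vertex I → Bool
    V = part I A B
    side : Vertex I → Vertex I → Bool
    side v w = if V v then V w else not (V w)
    own-side : ∀ v → suc q ≤ 2 * degIn I (side v) v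
    own-side (inj₁ p) = subst (λ n → suc q ≤ 2 * n) (sym (degIn-point (side (inj₁ p)) p)) (majority p)
    own-side (inj₂ l) = subst (λ n → suc q ≤ 2 * n) (sym (degIn-line (side (inj₂ l)) l)) (majority′ l)
    same-side : ∀ v a → V v ≡ a → deg I v ≤ 2 * degIn I (λ w → if a then V w else not (V w)) v
    same-side v a refl = subst (_≤ 2 * degIn I (side v) v) (sym (regular v)) (own-side v)

-- Pencils of an oval

on-oval-counts : ∀ {q n₀ n₁ n₂} → n₀ + n₁ + n₂ ≡ suc q → n₁ + 2 * n₂ ≡ suc q + q →
                 n₀ ≡ 0 × n₁ ≡ 1 × n₂ ≡ q
on-oval-counts {q} {n₀} {n₁} {n₂} size incidences =
  n₀≡0 , n₁≡1 , suc-injective (trans (sym (cong₂ (λ a b → a + b + n₂) n₀≡0 n₁≡1)) size)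
  where
  open ≡-Reasoning
  regroup : ∀ n₀ n₁ n₂ → 2 * n₀ + n₁ + (n₁ + 2 * n₂) ≡ 2 * (n₀ + n₁ + n₂)
  regroup = solve-∀
  twice : ∀ q → 2 * suc q ≡ 1 + (suc q + q)
  twice = solve-∀
  shape : ∀ a b → 2 * suc a + b ≡ 2 + (2 * a + b)
  shape = solve-∀
  2n₀+n₁≡1 : 2 * n₀ + n₁ ≡ 1
  2n₀+n₁≡1 = +-cancelʳ-≡ (n₁ + 2 * n₂) (2 * n₀ + n₁) 1 (begin
    2 * n₀ + n₁ + (n₁ + 2 * n₂) ≡⟨ regroup n₀ n₁ n₂ ⟩
    2 * (n₀ + n₁ + n₂)          ≡⟨ cong (2 *_) size ⟩
    2 * suc q                   ≡⟨ twice q ⟩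
    1 + (suc q + q)             ≡⟨ cong suc incidences ⟨
    1 + (n₁ + 2 * n₂)           ∎)
  zero-of : ∀ a b → 2 * a + b ≡ 1 → a ≡ 0
  zero-of zero    b _ = refl
  zero-of (suc a) b e = contradiction (trans (sym e) (shape a b)) λ ()
  n₀≡0 : n₀ ≡ 0
  n₀≡0 = zero-of n₀ n₁ 2n₀+n₁≡1
  n₁≡1 : n₁ ≡ 1
  n₁≡1 = subst (λ n → 2 * n + n₁ ≡ 1) n₀≡0 2n₀+n₁≡1

-- Profile q b n₀ n₁ n₂: a point, on the oval iff b, lies on n_k lines meeting the oval in k points.
data Profile (q : ℕ) : Bool → ℕ → ℕ → ℕ → Set where
  on       : Profile q true 0 1 q
  interior : ∀ {h} → suc q ≡ 2 * h     → Profile q false h 0 h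
  exterior : ∀ {h} → suc q ≡ 2 * suc h → Profile q false h 2 h

odd⇒n₁≢1 : ∀ {q n₁ n₂} → q % 2 ≡ 1 → n₁ + 2 * n₂ ≡ suc q → n₁ ≢ 1
odd⇒n₁≢1 {q} {n₂ = n₂} odd incidences refl = contradiction (begin
  0             ≡⟨ m*n%n≡0 n₂ 2 ⟨
  (n₂ * 2) % 2  ≡⟨ cong (_% 2) (trans (*-comm n₂ 2) (suc-injective incidences)) ⟩
  q % 2         ≡⟨ odd ⟩
  1             ∎) λ ()
  where open ≡-Reasoning

profile-of : ∀ {q b n₀ n₁ n₂} → q % 2 ≡ 1 → n₀ + n₁ + n₂ ≡ suc q →
             n₁ + 2 * n₂ ≡ suc q + q * 𝟙 b → n₁ ≤ 2 → Profile q b n₀ n₁ n₂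
profile-of {q} {true} {n₀} {n₁} {n₂} _ size incidences _
  with on-oval-counts {q} {n₀} {n₁} {n₂} size (trans incidences (cong (suc q +_) (*-identityʳ q)))
... | refl , refl , refl = on
profile-of {q} {false} {n₀} {n₁} {n₂} odd size incidences n₁≤2 =
  off (+-cancelʳ-≡ (n₁ + n₂) n₀ n₂ balance) incidences′ n₁≤2
  where
  incidences′ : n₁ + 2 * n₂ ≡ suc q
  incidences′ = trans incidences (trans (cong (suc q +_) (*-zeroʳ q)) (+-identityʳ (suc q)))
  regroup : ∀ n₀ n₁ n₂ → n₀ + n₁ + n₂ ≡ n₀ + (n₁ + n₂)
  regroup = solve-∀
  regroup′ : ∀ n₁ n₂ → n₁ + 2 * n₂ ≡ n₂ + (n₁ + n₂)
  regroup′ = solve-∀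
  shape : ∀ h → 2 + 2 * h ≡ 2 * suc h
  shape = solve-∀
  balance : n₀ + (n₁ + n₂) ≡ n₂ + (n₁ + n₂)
  balance = trans (sym (regroup n₀ n₁ n₂)) (trans size (trans (sym incidences′) (regroup′ n₁ n₂)))
  off : ∀ {h n₁} → n₀ ≡ h → n₁ + 2 * h ≡ suc q → n₁ ≤ 2 → Profile q false n₀ n₁ h
  off     refl e z≤n             = interior (sym e)
  off {h} refl e (s≤s z≤n)       = contradiction refl (odd⇒n₁≢1 {n₂ = h} odd e)
  off     refl e (s≤s (s≤s z≤n)) = exterior (trans (sym e) (shape n₀))

is0 is2 is≤1 : ℕ → Bool
is0 k = k ≡ᵇ 0
is2 k = k ≡ᵇ 2
is≤1 k = if k ≡ᵇ 0 then true else k ≡ᵇ 1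

profile-on : ∀ {q b n₀ n₁ n₂} → Profile q b n₀ n₁ n₂ → b ≡ (n₁ ≡ᵇ 1)
profile-on on           = refl
profile-on (interior _) = refl
profile-on (exterior _) = refl

profile-interior : ∀ {q b n₀ n₁ n₂} → Profile q b n₀ n₁ n₂ → (not b ∧ is0 n₁) ≡ is0 n₁
profile-interior on           = refl
profile-interior (interior _) = refl
profile-interior (exterior _) = refl

profile-exterior : ∀ {q b n₀ n₁ n₂} → Profile q b n₀ n₁ n₂ → (not b ∧ is2 n₁) ≡ is2 n₁
profile-exterior on           = refl
profile-exterior (interior _) = refl
profile-exterior (exterior _) = refl

profile-exterior-skew : ∀ {q b n₀ n₂} → 2 ≤ q → Profile q b n₀ 2 n₂ → 0 < n₀
profile-exterior-skew {n₀ = suc _} _             (exterior _)  = z<s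
profile-exterior-skew {n₀ = zero}  (s≤s (s≤s _)) (exterior ())

-- A vertex on side a, whose neighbours of level k ∈ {0, 1, 2} lie on side χ k, has at least half
-- of its q + 1 neighbours on its own side.
Balanced : ℕ → Bool → (ℕ → Bool) → ℕ → ℕ → ℕ → Set
Balanced q a χ n₀ n₁ n₂ = suc q ≤ 2 * tally (λ k → if a then χ k else not (χ k)) n₀ n₁ n₂

module _ {q : ℕ} where

  private
    half : ∀ {h} → suc q ≡ 2 * h → suc q ≤ 2 * (h + 0 + 0)
    half {h} e = ≤-reflexive (trans e (cong (2 *_) (sym (trans (+-identityʳ (h + 0)) (+-identityʳ h)))))

    half+1 : ∀ {h} → suc q ≡ 2 * suc h → suc q ≤ 2 * (h + 2 + 0)
    half+1 {h} e = ≤-trans (≤-reflexive e) (*-monoʳ-≤ 2 (≤-trans (n≤1+n (suc h)) (≤-reflexive (sym (shape h)))))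
      where
      shape : ∀ h → h + 2 + 0 ≡ suc (suc h)
      shape = solve-∀

    double : 1 ≤ q → suc q ≤ 2 * q
    double 1≤q = ≤-trans (+-monoˡ-≤ q 1≤q) (≤-reflexive (cong (q +_) (sym (+-identityʳ q))))

  balanced-is0-is0 : ∀ {b n₀ n₁ n₂} → Profile q b n₀ n₁ n₂ → Balanced q (is0 n₁) is0 n₀ n₁ n₂
  balanced-is0-is0 on               = m≤m+n (suc q) (suc q + 0)
  balanced-is0-is0 (interior {h} e) = half {h} e
  balanced-is0-is0 (exterior {h} e) = ≤-trans (≤-reflexive e) (*-monoʳ-≤ 2 (n≤1+n (suc h)))

  balanced-is2-is≤1 : 1 ≤ q → ∀ {b n₀ n₁ n₂} → Profile q b n₀ n₁ n₂ → Balanced q (is2 n₁) is≤1 n₀ n₁ n₂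
  balanced-is2-is≤1 1≤q on               = double 1≤q
  balanced-is2-is≤1 1≤q (interior e)     = ≤-reflexive e
  balanced-is2-is≤1 1≤q (exterior {h} e) = half+1 {h} e

  balanced-is≤1-is2 : 1 ≤ q → ∀ {b n₀ n₁ n₂} → Profile q b n₀ n₁ n₂ → Balanced q (is≤1 n₁) is2 n₀ n₁ n₂
  balanced-is≤1-is2 1≤q on               = double 1≤q
  balanced-is≤1-is2 1≤q (interior e)     = ≤-reflexive e
  balanced-is≤1-is2 1≤q (exterior {h} e) = half+1 {h} e

module Oval {q np nl : ℕ} {I : Fin np → Fin nl → Bool} (P : IsProjectivePlane q np nl I)
            {K : Fin np → Bool} (|K| : count K ≡ suc q) (meet≤2 : ∀ l → meet I K l ≤ 2) where
  open IsProjectivePlane P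
  open Plane P
  module Dual = Plane (dual P)

  linesMeeting : ℕ → Fin np → ℕ
  linesMeeting k p = count (λ l → I p l ∧ (meet I K l ≡ᵇ k))

  tangent : Fin nl → Bool
  tangent l = meet I K l ≡ᵇ 1

  pencil-size : ∀ p → linesMeeting 0 p + linesMeeting 1 p + linesMeeting 2 p ≡ suc q
  pencil-size p = begin
    linesMeeting 0 p + linesMeeting 1 p + linesMeeting 2 p ≡⟨ count-by-level meet≤2 (I p) (λ _ → true) ⟨
    count (λ l → I p l ∧ true)                             ≡⟨ count-cong (∧-identityʳ ∘ I p) ⟩
    count (I p)                                            ≡⟨ point-degree p ⟩
    suc q                                                  ∎
    where open ≡-Reasoning

  pencil-incidences : ∀ p → linesMeeting 1 p + 2 * linesMeeting 2 p ≡ suc q + q * 𝟙 (K p)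
  pencil-incidences p = begin
    linesMeeting 1 p + 2 * linesMeeting 2 p
      ≡⟨ cong₂ (λ x y → x + 2 * y) (count≡∑𝟙 (level 1)) (count≡∑𝟙 (level 2)) ⟩
    ∑[ l < nl ] 𝟙 (level 1 l) + 2 * ∑[ l < nl ] 𝟙 (level 2 l)
      ≡⟨ cong (∑[ l < nl ] 𝟙 (level 1 l) +_) (*-distribˡ-sum 2 (𝟙 ∘ level 2)) ⟩
    ∑[ l < nl ] 𝟙 (level 1 l) + ∑[ l < nl ] (2 * 𝟙 (level 2 l))
      ≡⟨ ∑-distrib-+ (𝟙 ∘ level 1) (λ l → 2 * 𝟙 (level 2 l)) ⟨
    ∑[ l < nl ] (𝟙 (level 1 l) + 2 * 𝟙 (level 2 l))
      ≡⟨ sum-cong-≗ {nl} (λ l → split (I p l) (meet≤2 l)) ⟨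
    ∑[ l < nl ] (𝟙 (I p l) * meet I K l)
      ≡⟨ ∑-meet-through K p ⟩
    count K + q * 𝟙 (K p)
      ≡⟨ cong (_+ q * 𝟙 (K p)) |K| ⟩
    suc q + q * 𝟙 (K p) ∎
    where
    open ≡-Reasoning
    level : ℕ → Fin nl → Bool
    level k l = I p l ∧ (meet I K l ≡ᵇ k)
    split : ∀ {m} x → m ≤ 2 → 𝟙 x * m ≡ 𝟙 (x ∧ (m ≡ᵇ 1)) + 2 * 𝟙 (x ∧ (m ≡ᵇ 2))
    split false _               = refl
    split true  z≤n             = refl
    split true  (s≤s z≤n)       = refl
    split true  (s≤s (s≤s z≤n)) = refl

  oval-point-counts : ∀ {p} → K p ≡ true →
                      linesMeeting 0 p ≡ 0 × linesMeeting 1 p ≡ 1 × linesMeeting 2 p ≡ q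
  oval-point-counts {p} Kp = on-oval-counts (pencil-size p)
    (trans (pencil-incidences p) (cong (suc q +_) (trans (cong (λ b → q * 𝟙 b) Kp) (*-identityʳ q))))

  count-tangents : count tangent ≡ suc q
  count-tangents = begin
    count tangent                             ≡⟨ ∑𝟙*≡count {nl} {tangent} {meet I K} (λ _ → ≡ᵇ-true⇒≡) ⟨
    ∑[ l < nl ] (𝟙 (tangent l) * meet I K l)  ≡⟨ ∑-flags I K tangent ⟨
    ∑[ p < np ] (𝟙 (K p) * linesMeeting 1 p)  ≡⟨ ∑𝟙*≡count {np} {K} {linesMeeting 1} tangents-at-K ⟩
    count K                                   ≡⟨ |K| ⟩
    suc q                                     ∎
    where
    open ≡-Reasoning
    tangents-at-K : ∀ p → K p ≡ true → linesMeeting 1 p ≡ 1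
    tangents-at-K p = proj₁ ∘ proj₂ ∘ oval-point-counts {p}

  ∑-tangents-along : ∀ {l} → tangent l ≡ true → ∑[ x < np ] (𝟙 (I x l) * linesMeeting 1 x) ≡ suc q + q
  ∑-tangents-along {l} tl = trans (Dual.∑-meet-through tangent l)
    (cong₂ _+_ count-tangents (trans (cong (λ b → q * 𝟙 b) tl) (*-identityʳ q)))

  ∑-points-along : ∀ {l} → tangent l ≡ true →
                   ∑[ x < np ] (𝟙 (I x l) + 𝟙 (I x l ∧ not (K x))) ≡ suc q + q
  ∑-points-along {l} tl = begin
    ∑[ x < np ] (𝟙 (I x l) + 𝟙 (I x l ∧ not (K x)))
      ≡⟨ ∑-distrib-+ (λ x → 𝟙 (I x l)) (λ x → 𝟙 (I x l ∧ not (K x))) ⟩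
    ∑[ x < np ] 𝟙 (I x l) + ∑[ x < np ] 𝟙 (I x l ∧ not (K x))
      ≡⟨ cong₂ _+_ (count≡∑𝟙 (λ x → I x l)) (count≡∑𝟙 (λ x → I x l ∧ not (K x))) ⟨
    count (λ x → I x l) + count (λ x → I x l ∧ not (K x))
      ≡⟨ cong₂ _+_ (line-size l) off-K ⟩
    suc q + q ∎
    where
    open ≡-Reasoning
    off-K : count (λ x → I x l ∧ not (K x)) ≡ q
    off-K = suc-injective (begin
      1 + count (λ x → I x l ∧ not (K x))           ≡⟨ cong (_+ count (λ x → I x l ∧ not (K x))) (≡ᵇ-true⇒≡ {meet I K l} tl) ⟨
      meet I K l + count (λ x → I x l ∧ not (K x))  ≡⟨ count-∧-not (λ x → I x l) K ⟩
      count (λ x → I x l)                           ≡⟨ line-size l ⟩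
      suc q                                         ∎)

  ∃-on : ∃ λ p → K p ≡ true
  ∃-on = count>0⇒∃ K (subst (0 <_) (sym |K|) z<s)

  ∃-secant-at : ∀ {p} → 1 ≤ q → K p ≡ true → ∃ λ l → (I p l ∧ is2 (meet I K l)) ≡ true
  ∃-secant-at 1≤q Kp = count>0⇒∃ _ (subst (0 <_) (sym (proj₂ (proj₂ (oval-point-counts Kp)))) 1≤q)

  module _ (odd : q % 2 ≡ 1) where

    off-oval-n₁≢1 : ∀ {p} → K p ≡ false → linesMeeting 1 p ≢ 1
    off-oval-n₁≢1 {p} Kp = odd⇒n₁≢1 {n₂ = linesMeeting 2 p} odd (trans (pencil-incidences p)
      (trans (cong (suc q +_) (trans (cong (λ b → q * 𝟙 b) Kp) (*-zeroʳ q))) (+-identityʳ (suc q))))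

    -- Summed over the points of a tangent l, the numbers of tangents give (q + 1) + q, as every
    -- other tangent meets l once. The point of K on l contributes one and, by parity, each of the
    -- q others at least two, so each of these lies on exactly two tangents.
    on-tangent⇒two-tangents : ∀ {p} → K p ≡ false → 0 < linesMeeting 1 p → linesMeeting 1 p ≡ 2
    on-tangent⇒two-tangents {p} Kp t>0 with count>0⇒∃ _ t>0
    ... | l , Ipl∧tl = at-p (∧-conicalˡ (I p l) _ Ipl∧tl) Kp
      (∑-tight lower≤ (≤-reflexive (trans (∑-tangents-along tl) (sym (∑-points-along tl)))) p)
      where
      tl : tangent l ≡ true
      tl = ∧-conicalʳ (I p l) _ Ipl∧tl
      lower-bound : ∀ {a b} n → (a ≡ true → b ≡ true → n ≡ 1) → (a ≡ true → b ≡ false → 2 ≤ n) →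
                    𝟙 a + 𝟙 (a ∧ not b) ≤ 𝟙 a * n
      lower-bound {false}         n _   _   = z≤n
      lower-bound {true}  {true}  n one _   = ≤-reflexive (sym (trans (+-identityʳ n) (one refl refl)))
      lower-bound {true}  {false} n _   two = ≤-trans (two refl refl) (≤-reflexive (sym (+-identityʳ n)))
      lower≤ : ∀ x → 𝟙 (I x l) + 𝟙 (I x l ∧ not (K x)) ≤ 𝟙 (I x l) * linesMeeting 1 x
      lower≤ x = lower-bound (linesMeeting 1 x) (λ _ Kx → proj₁ (proj₂ (oval-point-counts Kx)))
        (λ Ixl Kx → ≤∧≢⇒< (∃⇒count>0 (λ l′ → I x l′ ∧ tangent l′) (cong₂ _∧_ Ixl tl)) (≢-sym (off-oval-n₁≢1 Kx)))
      at-p : ∀ {a b n} → a ≡ true → b ≡ false → 𝟙 a + 𝟙 (a ∧ not b) ≡ 𝟙 a * n → n ≡ 2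
      at-p {n = n} refl refl e = sym (trans e (+-identityʳ n))

    tangents≤2 : ∀ p → linesMeeting 1 p ≤ 2
    tangents≤2 p with K p in Kp
    ... | true  = ≤-trans (≤-reflexive (proj₁ (proj₂ (oval-point-counts Kp)))) (s≤s z≤n)
    ... | false with linesMeeting 1 p in t
    ...   | zero  = z≤n
    ...   | suc _ = ≤-reflexive (trans (sym t) (on-tangent⇒two-tangents Kp (subst (0 <_) (sym t) z<s)))

    profile : ∀ p → Profile q (K p) (linesMeeting 0 p) (linesMeeting 1 p) (linesMeeting 2 p)
    profile p = profile-of odd (pencil-size p) (pencil-incidences p) (tangents≤2 p)

    ∃-skew-at : ∀ {p} → 2 ≤ q → linesMeeting 1 p ≡ 2 → ∃ λ l → (I p l ∧ is0 (meet I K l)) ≡ true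
    ∃-skew-at {p} 2≤q t≡2 = count>0⇒∃ _ (profile-exterior-skew 2≤q
      (subst (λ n → Profile q (K p) (linesMeeting 0 p) n (linesMeeting 2 p)) t≡2 (profile p)))

    majority : (ψ χ : ℕ → Bool) → (∀ {b n₀ n₁ n₂} → Profile q b n₀ n₁ n₂ → Balanced q (ψ n₁) χ n₀ n₁ n₂) →
               {A : Fin np → Bool} {B : Fin nl → Bool} →
               (∀ p → A p ≡ ψ (linesMeeting 1 p)) → (∀ l → B l ≡ χ (meet I K l)) → Majority q I A B
    majority ψ χ balanced {A} {B} A≗ B≗ p = subst (λ n → suc q ≤ 2 * n) (sym by-level) (balanced (profile p))
      where
      χ′ : ℕ → Bool
      χ′ k = if ψ (linesMeeting 1 p) then χ k else not (χ k)
      by-level : count (λ l → I p l ∧ (if A p then B l else not (B l))) ≡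
                 tally χ′ (linesMeeting 0 p) (linesMeeting 1 p) (linesMeeting 2 p)
      by-level = trans (count-cong λ l → cong₂ (λ a b → I p l ∧ (if a then b else not b)) (A≗ p) (B≗ l))
                       (count-by-level meet≤2 (I p) χ′)

module OvalPartitions {q np nl : ℕ} {I : Fin np → Fin nl → Bool} (odd : q % 2 ≡ 1)
                      (P : IsProjectivePlane q np nl I) {O : Fin np → Bool} (oval : IsOval I q O) where
  open IsProjectivePlane P using (order≥2)
  open Plane P using (internal-part)
  module Points = Oval P (proj₂ oval) (arc⇒meet≤2 (proj₁ oval))
  module Lines  = Oval (dual P) Points.count-tangents (Points.tangents≤2 odd)

  τ : Fin np → ℕ
  τ = Points.linesMeeting 1

  on-oval-by-level : ∀ x → O x ≡ (τ x ≡ᵇ 1)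
  on-oval-by-level x = profile-on (Points.profile odd x)

  interior-by-level : ∀ x → isInterior I O x ≡ is0 (τ x)
  interior-by-level x = profile-interior (Points.profile odd x)

  exterior-by-level : ∀ x → isExterior I O x ≡ is2 (τ x)
  exterior-by-level x = profile-exterior (Points.profile odd x)

  meet≡oval-points : ∀ l → meet I O l ≡ Lines.linesMeeting 1 l
  meet≡oval-points l = count-cong λ x → cong (I x l ∧_) (on-oval-by-level x)

  1≤q : 1 ≤ q
  1≤q = ≤-trans (s≤s z≤n) order≥2

  oval-point : ∃ λ x → O x ≡ true
  oval-point = Points.∃-on

  tangent-line : ∃ λ l → Points.tangent l ≡ true
  tangent-line = Lines.∃-on

  exterior-on-tangent : ∃ λ x → (I x (proj₁ tangent-line) ∧ is2 (τ x)) ≡ true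
  exterior-on-tangent = Lines.∃-secant-at 1≤q (proj₂ tangent-line)

  skew-line : ∃ λ l → isSkew I O l ≡ true
  skew-line = map₂ (λ {l} → ∧-conicalʳ (I x l) (isSkew I O l)) (Points.∃-skew-at odd order≥2 two-tangents)
    where
    x : Fin np
    x = proj₁ exterior-on-tangent
    two-tangents : τ x ≡ 2
    two-tangents = ≡ᵇ-true⇒≡ (∧-conicalʳ (I x (proj₁ tangent-line)) (is2 (τ x)) (proj₂ exterior-on-tangent))

  interior-partition : IsInternalPartition I (part I (isInterior I O) (isSkew I O))
  interior-partition = internal-part {isInterior I O} {isSkew I O}
    (inj₂ (proj₁ skew-line) , proj₂ skew-line)
    (inj₁ (proj₁ oval-point) , cong (λ b → not b ∧ is0 (τ (proj₁ oval-point))) (proj₂ oval-point))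
    (Points.majority odd is0 is0 balanced-is0-is0 interior-by-level (λ _ → refl))
    (Lines.majority odd is0 is0 balanced-is0-is0 (cong is0 ∘ meet≡oval-points) interior-by-level)

  exterior-partition : IsInternalPartition I (part I (isExterior I O) (isSkewOrTangent I O))
  exterior-partition = internal-part {isExterior I O} {isSkewOrTangent I O}
    (inj₂ (proj₁ tangent-line) , cong is≤1 (≡ᵇ-true⇒≡ {meet I O (proj₁ tangent-line)} (proj₂ tangent-line)))
    (inj₁ (proj₁ oval-point) , cong (λ b → not b ∧ is2 (τ (proj₁ oval-point))) (proj₂ oval-point))
    (Points.majority odd is2 is≤1 (balanced-is2-is≤1 1≤q) exterior-by-level (λ _ → refl))
    (Lines.majority odd is≤1 is2 (balanced-is≤1-is2 1≤q) (cong is≤1 ∘ meet≡oval-points) exterior-by-level)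

proposition2 : (q np nl : ℕ) (I : Fin np → Fin nl → Bool) → q % 2 ≡ 1 →
    IsProjectivePlane q np nl I → (O : Fin np → Bool) → IsOval I q O →
    IsInternalPartition I (part I (isInterior I O) (isSkew I O))
    × IsInternalPartition I (part I (isExterior I O) (isSkewOrTangent I O))
proposition2 q np nl I odd P O oval = interior-partition , exterior-partition
  where open OvalPartitions odd P oval
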